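{- Let $n,k$ be integers with $0<k<n$ and $n\ge 2k-1$. Then $$M^{[k]}(1,n)=\left\lceil\frac{n}{k}\right\rceil-2+\left\lceil\log_2\left(n-\left(\left\lceil\frac{n}{k}\right\rceil-2\right)k\right)\right\rceil.$$
   Context: Group testing setting: a population of $n$ items contains exactly $d$ defective items, where $d$ is known in advance. A test is applied to a subset of the population and its outcome is positive if the subset contains at least one defective item and negative otherwise. Tests are performed sequentially (adaptively): the result of each test is known before the next test is chosen. An algorithm solves the $(d,n)$-problem if it always identifies the set of defective items. $M^{[k]}(d,n)$ denotes the minimum, over all such sequential algorithms in which every tested subset has size exactly $k$, of the worst-case number of tests used; if no such algorithm exists, $M^{[k]}(d,n)=\infty$. -}

module Defs where

open import Data.Nat using (ℕ; zero; suc; _+_; _*_; _∸_; _≤_; _/_)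
open import Data.Bool using (Bool; true; false)
open import Data.Fin.Subset using (Subset; ∣_∣; _∩_)
open import Data.Fin.Subset.Properties using (nonempty?)
open import Relation.Nullary using (does)
open import Relation.Binary.PropositionalEquality using (_≡_)
open import Data.Product using (Σ; _×_)
open import Data.Unit using (⊤)

-- An adaptive (sequential) group-testing algorithm on a population Fin n,
-- given as a binary decision tree: each internal node tests a subset,
-- and continues in the positive or negative branch; a leaf outputs the
-- claimed set of defectives.
data Alg (n : ℕ) : Set where
  output : Subset n → Alg n
  test   : (S : Subset n) → (ifPos ifNeg : Alg n) → Alg n

positive : {n : ℕ} → Subset n → Subset n → Bool
positive S D = does (nonempty? (S ∩ D))

result : {n : ℕ} → Alg n → Subset n → Subset n
result (output R) D = R
result (test S p q) D with positive S D
... | true  = result p D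
... | false = result q D

numTests : {n : ℕ} → Alg n → Subset n → ℕ
numTests (output R) D = 0
numTests (test S p q) D with positive S D
... | true  = suc (numTests p D)
... | false = suc (numTests q D)

AllTestsSize : {n : ℕ} → ℕ → Alg n → Set
AllTestsSize k (output R) = ⊤
AllTestsSize k (test S p q) = (∣ S ∣ ≡ k) × (AllTestsSize k p × AllTestsSize k q)

Solves : (d n : ℕ) → Alg n → Set
Solves d n A = ∀ (D : Subset n) → ∣ D ∣ ≡ d → result A D ≡ D

WorstCaseAtMost : (d n : ℕ) → Alg n → ℕ → Set
WorstCaseAtMost d n A m = ∀ (D : Subset n) → ∣ D ∣ ≡ d → numTests A D ≤ m

Admissible : (k d n : ℕ) → Alg n → Set
Admissible k d n A = AllTestsSize k A × Solves d n A

-- M^[k](d,n) = m  (as a finite value): m is attained by some admissible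
-- algorithm, and every admissible algorithm has worst case ≥ m.
M[_]≡ : (k d n m : ℕ) → Set
M[_]≡ k d n m =
  Σ (Alg n) (λ A → Admissible k d n A × WorstCaseAtMost d n A m)
  × (∀ (A : Alg n) → Admissible k d n A → ∀ m' → WorstCaseAtMost d n A m' → m ≤ m')

ceilDiv : ℕ → (k : ℕ) → ℕ
ceilDiv n zero = 0
ceilDiv n (suc j) = (n + j) / suc j

-- Let F(a) be the right-hand side with n replaced by a number a of candidates.
-- F(a) = ⌈log₂ a⌉ for a ≤ 2k, F(a) = 1 + F(a − k) for a > 2k, and F is monotone.
-- Lower bound: a test of size k splits the candidates into t ≤ k and s, and
-- F(t + s) ≤ 1 + max (F t) (F s); so, by induction on the decision tree, locating
-- the defective among a candidates takes F(a) tests in the worst case.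
-- Upper bound: while more than 2k candidates remain, test k of them; otherwise
-- test ⌈a/2⌉ of them padded with k − ⌈a/2⌉ non-candidates. The padding exists
-- because n ≥ 2k − 1 gives k + ⌊n/2⌋ ≤ n, and k + ⌊a/2⌋ ≤ n stays true as a shrinks.
module Submission where

open import Defs
open import Data.Bool using (true; false)
open import Data.Empty using (⊥-elim)
open import Data.Fin using (Fin)
open import Data.Fin.Subset
open import Data.Fin.Subset.Properties
open import Data.Nat
open import Data.Nat.DivMod using (m/n≡1+[m∸n]/n; /-monoˡ-≤; n/n≡1; m<n⇒m/n≡0)
open import Data.Nat.Induction using (<-rec; <-wellFounded)
open import Data.Nat.Logarithm
open import Data.Nat.Properties
open import Data.Product using (∃-syntax; _×_; _,_; proj₁; proj₂; map; map₁; map₂)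
open import Data.Unit using (tt)
open import Data.Vec using (_∷_; []; here; there)
open import Function using (id; _∘_; _⇔_; mk⇔; Equivalence)
open import Induction.WellFounded using (module All)
open import Relation.Binary.Construct.On as On using ()
open import Relation.Binary.Definitions using (tri<; tri≈; tri>)
open import Relation.Binary.PropositionalEquality
open import Relation.Nullary using (yes; no)
open import Relation.Nullary.Decidable using (dec-true; dec-false)

⌈log₂[n+n]⌉≤1+⌈log₂n⌉ : ∀ n → ⌈log₂ (n + n) ⌉ ≤ suc ⌈log₂ n ⌉
⌈log₂[n+n]⌉≤1+⌈log₂n⌉ zero        = n≤1+n _
⌈log₂[n+n]⌉≤1+⌈log₂n⌉ n@(suc _) = ≤-reflexive (begin
  ⌈log₂ (n + n) ⌉       ≡⟨ cong (λ m → ⌈log₂ (n + m) ⌉) (+-identityʳ n) ⟨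
  ⌈log₂ (2 * n) ⌉       ≡⟨ ⌈log₂2*n⌉≡1+⌈log₂n⌉ n ⟩
  suc ⌈log₂ n ⌉         ∎)
  where open ≡-Reasoning

k+⌊n/2⌋≤n : ∀ {k n} → 2 * k ≤ n + 1 → k + ⌊ n /2⌋ ≤ n
k+⌊n/2⌋≤n {k} {n} 2k≤n+1 = begin
  k + ⌊ n /2⌋       ≤⟨ +-monoˡ-≤ ⌊ n /2⌋ k≤⌈n/2⌉ ⟩
  ⌈ n /2⌉ + ⌊ n /2⌋ ≡⟨ +-comm ⌈ n /2⌉ ⌊ n /2⌋ ⟩
  ⌊ n /2⌋ + ⌈ n /2⌉ ≡⟨ ⌊n/2⌋+⌈n/2⌉≡n n ⟩
  n                 ∎
  where
  open ≤-Reasoning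
  k≤⌈n/2⌉ : k ≤ ⌈ n /2⌉
  k≤⌈n/2⌉ = begin
    k                 ≡⟨ n≡⌊n+n/2⌋ k ⟩
    ⌊ k + k /2⌋       ≡⟨ cong (λ m → ⌊ k + m /2⌋) (+-identityʳ k) ⟨
    ⌊ 2 * k /2⌋       ≤⟨ ⌊n/2⌋-mono 2k≤n+1 ⟩
    ⌊ n + 1 /2⌋       ≡⟨ cong ⌊_/2⌋ (+-comm n 1) ⟩
    ⌈ n /2⌉           ∎

∣p∩q∣+∣p∩∁q∣≡∣p∣ : ∀ {n} (p q : Subset n) → ∣ p ∩ q ∣ + ∣ p ∩ ∁ q ∣ ≡ ∣ p ∣
∣p∩q∣+∣p∩∁q∣≡∣p∣ []            []            = refl
∣p∩q∣+∣p∩∁q∣≡∣p∣ (inside  ∷ p) (inside  ∷ q) = cong suc (∣p∩q∣+∣p∩∁q∣≡∣p∣ p q)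
∣p∩q∣+∣p∩∁q∣≡∣p∣ (inside  ∷ p) (outside ∷ q) = trans (+-suc _ _) (cong suc (∣p∩q∣+∣p∩∁q∣≡∣p∣ p q))
∣p∩q∣+∣p∩∁q∣≡∣p∣ (outside ∷ p) (inside  ∷ q) = ∣p∩q∣+∣p∩∁q∣≡∣p∣ p q
∣p∩q∣+∣p∩∁q∣≡∣p∣ (outside ∷ p) (outside ∷ q) = ∣p∩q∣+∣p∩∁q∣≡∣p∣ p q

∃-∩-sizes : ∀ {n} (p : Subset n) {t u} → t ≤ ∣ p ∣ → u ≤ ∣ ∁ p ∣ →
            ∃[ q ] ∣ p ∩ q ∣ ≡ t × ∣ ∁ p ∩ q ∣ ≡ u
∃-∩-sizes []            z≤n         z≤n         = [] , refl , refl
∃-∩-sizes (inside  ∷ p) z≤n         u≤∣∁p∣      = map (outside ∷_) id (∃-∩-sizes p z≤n u≤∣∁p∣)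
∃-∩-sizes (inside  ∷ p) (s≤s t≤∣p∣) u≤∣∁p∣      = map (inside ∷_) (map₁ (cong suc)) (∃-∩-sizes p t≤∣p∣ u≤∣∁p∣)
∃-∩-sizes (outside ∷ p) t≤∣p∣       z≤n         = map (outside ∷_) id (∃-∩-sizes p t≤∣p∣ z≤n)
∃-∩-sizes (outside ∷ p) t≤∣p∣       (s≤s u≤∣∁p∣) = map (inside ∷_) (map₂ (cong suc)) (∃-∩-sizes p t≤∣p∣ u≤∣∁p∣)

∃-test-splitting : ∀ {n} (p : Subset n) {t u} → t ≤ ∣ p ∣ → u ≤ ∣ ∁ p ∣ →
                   ∃[ q ] ∣ q ∣ ≡ t + u × ∣ p ∩ q ∣ ≡ t × ∣ p ∩ ∁ q ∣ ≡ ∣ p ∣ ∸ t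
∃-test-splitting p {t} {u} t≤∣p∣ u≤∣∁p∣ with ∃-∩-sizes p t≤∣p∣ u≤∣∁p∣
... | q , ∣p∩q∣≡t , ∣∁p∩q∣≡u = q , ∣q∣≡t+u , ∣p∩q∣≡t , ∣p∩∁q∣≡∣p∣∸t
  where
  open ≡-Reasoning
  ∣q∣≡t+u : ∣ q ∣ ≡ t + u
  ∣q∣≡t+u = begin
    ∣ q ∣                       ≡⟨ ∣p∩q∣+∣p∩∁q∣≡∣p∣ q p ⟨
    ∣ q ∩ p ∣ + ∣ q ∩ ∁ p ∣     ≡⟨ cong₂ (λ a b → ∣ a ∣ + ∣ b ∣) (∩-comm q p) (∩-comm q (∁ p)) ⟩
    ∣ p ∩ q ∣ + ∣ ∁ p ∩ q ∣     ≡⟨ cong₂ _+_ ∣p∩q∣≡t ∣∁p∩q∣≡u ⟩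
    t + u                       ∎
  ∣p∩∁q∣≡∣p∣∸t : ∣ p ∩ ∁ q ∣ ≡ ∣ p ∣ ∸ t
  ∣p∩∁q∣≡∣p∣∸t = begin
    ∣ p ∩ ∁ q ∣                     ≡⟨ m+n∸m≡n t _ ⟨
    t + ∣ p ∩ ∁ q ∣ ∸ t             ≡⟨ cong (λ a → a + ∣ p ∩ ∁ q ∣ ∸ t) ∣p∩q∣≡t ⟨
    ∣ p ∩ q ∣ + ∣ p ∩ ∁ q ∣ ∸ t     ≡⟨ cong (_∸ t) (∣p∩q∣+∣p∩∁q∣≡∣p∣ p q) ⟩
    ∣ p ∣ ∸ t                       ∎

Empty⇒∣p∣≡0 : ∀ {n} {p : Subset n} → Empty p → ∣ p ∣ ≡ 0
Empty⇒∣p∣≡0 {n} ¬∃∈ = trans (cong ∣_∣ (Empty-unique ¬∃∈)) (∣⊥∣≡0 n)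

∣p∣≡0⇒p≡⊥ : ∀ {n} {p : Subset n} → ∣ p ∣ ≡ 0 → p ≡ ⊥
∣p∣≡0⇒p≡⊥ {p = []}          _      = refl
∣p∣≡0⇒p≡⊥ {p = inside  ∷ p} ()
∣p∣≡0⇒p≡⊥ {p = outside ∷ p} ∣p∣≡0 = cong (outside ∷_) (∣p∣≡0⇒p≡⊥ ∣p∣≡0)

x∈p∧∣p∣≤1⇒p≡⁅x⁆ : ∀ {n} {p : Subset n} {x} → x ∈ p → ∣ p ∣ ≤ 1 → p ≡ ⁅ x ⁆
x∈p∧∣p∣≤1⇒p≡⁅x⁆ {p = inside  ∷ p} here        (s≤s ∣p∣≤0) =
  cong (inside ∷_) (∣p∣≡0⇒p≡⊥ (n≤0⇒n≡0 ∣p∣≤0))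
x∈p∧∣p∣≤1⇒p≡⁅x⁆ {p = inside  ∷ p} (there x∈p) (s≤s ∣p∣≤0) =
  ⊥-elim (∉⊥ (subst (_ ∈_) (∣p∣≡0⇒p≡⊥ (n≤0⇒n≡0 ∣p∣≤0)) x∈p))
x∈p∧∣p∣≤1⇒p≡⁅x⁆ {p = outside ∷ p} (there x∈p) ∣p∣≤1 =
  cong (outside ∷_) (x∈p∧∣p∣≤1⇒p≡⁅x⁆ x∈p ∣p∣≤1)

∣p∣≡1⇒∃p≡⁅x⁆ : ∀ {n} {p : Subset n} → ∣ p ∣ ≡ 1 → ∃[ x ] p ≡ ⁅ x ⁆
∣p∣≡1⇒∃p≡⁅x⁆ {p = p} ∣p∣≡1 with nonempty? p
... | yes (x , x∈p) = x , x∈p∧∣p∣≤1⇒p≡⁅x⁆ x∈p (≤-reflexive ∣p∣≡1)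
... | no  ¬∃∈       = ⊥-elim (0≢1+n (trans (sym (Empty⇒∣p∣≡0 ¬∃∈)) ∣p∣≡1))

module _ {n : ℕ} where

  positive-∈ : ∀ {S : Subset n} {x} → x ∈ S → positive S ⁅ x ⁆ ≡ true
  positive-∈ {S} {x} x∈S = dec-true (nonempty? (S ∩ ⁅ x ⁆)) (x , x∈p∩q⁺ (x∈S , x∈⁅x⁆ x))

  positive-∉ : ∀ {S : Subset n} {x} → x ∉ S → positive S ⁅ x ⁆ ≡ false
  positive-∉ {S} {x} x∉S = dec-false (nonempty? (S ∩ ⁅ x ⁆)) λ (y , y∈S∩⁅x⁆) →
    let (y∈S , y∈⁅x⁆) = x∈p∩q⁻ S ⁅ x ⁆ y∈S∩⁅x⁆ in x∉S (subst (_∈ S) (x∈⁅y⁆⇒x≡y x y∈⁅x⁆) y∈S)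

  Finds : Alg n → ℕ → Fin n → Set
  Finds T m x = result T ⁅ x ⁆ ≡ ⁅ x ⁆ × numTests T ⁅ x ⁆ ≤ m

  Identifies : Alg n → ℕ → Subset n → Set
  Identifies T m C = ∀ {x} → x ∈ C → Finds T m x

  finds-mono : ∀ {T m m′ x} → m ≤ m′ → Finds T m x → Finds T m′ x
  finds-mono m≤m′ = map₂ (λ tests≤m → ≤-trans tests≤m m≤m′)

  finds-test-pos : ∀ {S p q m x} → positive S ⁅ x ⁆ ≡ true →
                   Finds (test S p q) (suc m) x ⇔ Finds p m x
  finds-test-pos pos rewrite pos = mk⇔ (map₂ s≤s⁻¹) (map₂ s≤s)

  finds-test-neg : ∀ {S p q m x} → positive S ⁅ x ⁆ ≡ false →
                   Finds (test S p q) (suc m) x ⇔ Finds q m x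
  finds-test-neg neg rewrite neg = mk⇔ (map₂ s≤s⁻¹) (map₂ s≤s)

  identifies-test⁻ : ∀ {S p q m C} → Identifies (test S p q) (suc m) C →
                     Identifies p m (C ∩ S) × Identifies q m (C ∩ ∁ S)
  identifies-test⁻ {S} {C = C} idC =
    (λ x∈C∩S → let (x∈C , x∈S) = x∈p∩q⁻ C S x∈C∩S in
      Equivalence.to (finds-test-pos (positive-∈ x∈S)) (idC x∈C)) ,
    (λ x∈C∩∁S → let (x∈C , x∈∁S) = x∈p∩q⁻ C (∁ S) x∈C∩∁S in
      Equivalence.to (finds-test-neg (positive-∉ (x∈∁p⇒x∉p x∈∁S))) (idC x∈C))

  identifies-test : ∀ {S p q m₁ m₂ m C} → Identifies p m₁ (C ∩ S) → Identifies q m₂ (C ∩ ∁ S) →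
                    m₁ < m → m₂ < m → Identifies (test S p q) m C
  identifies-test {S} idp idq m₁<m m₂<m {x} x∈C with x ∈? S
  ... | yes x∈S = finds-mono m₁<m
    (Equivalence.from (finds-test-pos (positive-∈ x∈S)) (idp (x∈p∩q⁺ (x∈C , x∈S))))
  ... | no  x∉S = finds-mono m₂<m
    (Equivalence.from (finds-test-neg (positive-∉ x∉S)) (idq (x∈p∩q⁺ (x∈C , x∉p⇒x∈∁p x∉S))))

  numTests-test>0 : ∀ S p q (D : Subset n) → 0 < numTests (test S p q) D
  numTests-test>0 S p q D with positive S D
  ... | true  = z<s
  ... | false = z<s

  identifies-test-0 : ∀ {S p q C} → Identifies (test S p q) 0 C → ∣ C ∣ ≡ 0
  identifies-test-0 {S} {p} {q} idC =
    Empty⇒∣p∣≡0 λ (x , x∈C) → <⇒≱ (numTests-test>0 S p q ⁅ x ⁆) (proj₂ (idC x∈C))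

  identifies-output⁻ : ∀ {R m C} → Identifies (output R) m C → ∣ C ∣ ≤ 1
  identifies-output⁻ {C = C} idC with nonempty? C
  ... | yes (x , x∈C) = subst (∣ C ∣ ≤_) (∣⁅x⁆∣≡1 x) (p⊆q⇒∣p∣≤∣q∣ C⊆⁅x⁆)
    where
    C⊆⁅x⁆ : C ⊆ ⁅ x ⁆
    C⊆⁅x⁆ {y} y∈C = subst (y ∈_) (trans (sym (proj₁ (idC y∈C))) (proj₁ (idC x∈C))) (x∈⁅x⁆ y)
  ... | no  ¬∃∈       = ≤-trans (≤-reflexive (Empty⇒∣p∣≡0 ¬∃∈)) z≤n

  identifies-output : ∀ {m C} → ∣ C ∣ ≤ 1 → Identifies (output C) m C
  identifies-output ∣C∣≤1 x∈C = x∈p∧∣p∣≤1⇒p≡⁅x⁆ x∈C ∣C∣≤1 , z≤n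

  ∀-singleton : {P : Subset n → Set} → (∀ x → P ⁅ x ⁆) → ∀ D → ∣ D ∣ ≡ 1 → P D
  ∀-singleton P⁅_⁆ D ∣D∣≡1 with ∣p∣≡1⇒∃p≡⁅x⁆ {p = D} ∣D∣≡1
  ... | x , refl = P⁅ x ⁆

  identifies⇒solves : ∀ {T m} → Identifies T m ⊤ → Solves 1 n T × WorstCaseAtMost 1 n T m
  identifies⇒solves idT = ∀-singleton (λ _ → proj₁ (idT ∈⊤)) , ∀-singleton (λ _ → proj₂ (idT ∈⊤))

  solves⇒identifies : ∀ {T m} → Solves 1 n T → WorstCaseAtMost 1 n T m → Identifies T m ⊤
  solves⇒identifies solves worst {x} _ = solves ⁅ x ⁆ (∣⁅x⁆∣≡1 x) , worst ⁅ x ⁆ (∣⁅x⁆∣≡1 x)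

module Cost (j : ℕ) where

  k : ℕ
  k = suc j

  -- ⌈a/k⌉ − 2 tests of k candidates each, then a binary search on the at most 2k left.
  fullTests : ℕ → ℕ
  fullTests a = ceilDiv a k ∸ 2

  cost : ℕ → ℕ
  cost a = fullTests a + ⌈log₂ (a ∸ fullTests a * k) ⌉

  ceilDiv-mono-≤ : ∀ {a b} → a ≤ b → ceilDiv a k ≤ ceilDiv b k
  ceilDiv-mono-≤ a≤b = /-monoˡ-≤ k (+-monoˡ-≤ j a≤b)

  ceilDiv-+k : ∀ b → ceilDiv (b + k) k ≡ suc (ceilDiv b k)
  ceilDiv-+k b = begin
    (b + k + j) / k         ≡⟨ m/n≡1+[m∸n]/n (≤-trans (m≤n+m k b) (m≤m+n (b + k) j)) ⟩
    suc ((b + k + j ∸ k) / k) ≡⟨ cong (λ m → suc (m / k)) b+k+j∸k≡b+j ⟩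
    suc ((b + j) / k)        ∎
    where
    open ≡-Reasoning
    b+k+j∸k≡b+j : b + k + j ∸ k ≡ b + j
    b+k+j∸k≡b+j = begin
      b + k + j ∸ k   ≡⟨ cong (_∸ k) (+-assoc b k j) ⟩
      b + (k + j) ∸ k ≡⟨ cong (λ m → b + m ∸ k) (+-comm k j) ⟩
      b + (j + k) ∸ k ≡⟨ cong (_∸ k) (+-assoc b j k) ⟨
      b + j + k ∸ k   ≡⟨ m+n∸n≡m (b + j) k ⟩
      b + j           ∎

  ceilDiv-1+k : ceilDiv (suc k) k ≡ 2
  ceilDiv-1+k = trans (ceilDiv-+k 1) (cong suc (n/n≡1 k))

  ceilDiv-2k : ceilDiv (k + k) k ≡ 2
  ceilDiv-2k = trans (ceilDiv-+k k) (cong suc (trans (ceilDiv-+k 0) (cong suc (m<n⇒m/n≡0 (n<1+n j)))))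

  ceilDiv-≤-2 : ∀ {a} → a ≤ k + k → ceilDiv a k ≤ 2
  ceilDiv-≤-2 a≤2k = ≤-trans (ceilDiv-mono-≤ a≤2k) (≤-reflexive ceilDiv-2k)

  2≤ceilDiv : ∀ {b} → k < b → 2 ≤ ceilDiv b k
  2≤ceilDiv k<b = ≤-trans (≤-reflexive (sym ceilDiv-1+k)) (ceilDiv-mono-≤ k<b)

  fullTests-+k : ∀ {b} → k < b → fullTests (b + k) ≡ suc (fullTests b)
  fullTests-+k {b} k<b =
    trans (cong (_∸ 2) (ceilDiv-+k b)) (+-∸-assoc 1 (2≤ceilDiv k<b))

  cost-≤2k : ∀ {a} → a ≤ k + k → cost a ≡ ⌈log₂ a ⌉
  cost-≤2k {a} a≤2k =
    cong (λ i → i + ⌈log₂ (a ∸ i * k) ⌉) (m≤n⇒m∸n≡0 (ceilDiv-≤-2 a≤2k))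

  cost-+k : ∀ {b} → k < b → cost (b + k) ≡ suc (cost b)
  cost-+k {b} k<b = begin
    cost (b + k)                                  ≡⟨ cong (λ i → i + ⌈log₂ (b + k ∸ i * k) ⌉) (fullTests-+k k<b) ⟩
    suc (i + ⌈log₂ (b + k ∸ (k + i * k)) ⌉)       ≡⟨ cong (λ m → suc (i + ⌈log₂ m ⌉)) b+k∸[k+ik]≡b∸ik ⟩
    suc (cost b)                                  ∎
    where
    open ≡-Reasoning
    i = fullTests b
    b+k∸[k+ik]≡b∸ik : b + k ∸ (k + i * k) ≡ b ∸ i * k
    b+k∸[k+ik]≡b∸ik = trans (sym (∸-+-assoc (b + k) k (i * k))) (cong (_∸ i * k) (m+n∸n≡m b k))

  cost->2k : ∀ {a} → k + k < a → cost a ≡ suc (cost (a ∸ k))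
  cost->2k {a} 2k<a = begin
    cost a            ≡⟨ cong cost (sym (m∸n+n≡m k≤a)) ⟩
    cost (a ∸ k + k)  ≡⟨ cost-+k k<a∸k ⟩
    suc (cost (a ∸ k)) ∎
    where
    open ≡-Reasoning
    k≤a : k ≤ a
    k≤a = ≤-trans (m≤m+n k k) (<⇒≤ 2k<a)
    k<a∸k : k < a ∸ k
    k<a∸k = m+n≤o⇒m≤o∸n (suc k) 2k<a

  cost-≤-suc : ∀ a → cost a ≤ cost (suc a)
  cost-≤-suc = <-rec _ step
    where
    open ≤-Reasoning
    step : ∀ a → (∀ {b} → b < a → cost b ≤ cost (suc b)) → cost a ≤ cost (suc a)
    step a rec with <-cmp a (k + k)
    ... | tri< a<2k _ _ = begin
      cost a           ≡⟨ cost-≤2k (<⇒≤ a<2k) ⟩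
      ⌈log₂ a ⌉        ≤⟨ ⌈log₂⌉-mono-≤ (n≤1+n a) ⟩
      ⌈log₂ (suc a) ⌉  ≡⟨ cost-≤2k a<2k ⟨
      cost (suc a)     ∎
    ... | tri≈ _ refl _ = begin
      cost (k + k)            ≡⟨ cost-≤2k ≤-refl ⟩
      ⌈log₂ (k + k) ⌉         ≤⟨ ⌈log₂[n+n]⌉≤1+⌈log₂n⌉ k ⟩
      suc ⌈log₂ k ⌉           ≤⟨ s≤s (⌈log₂⌉-mono-≤ (n≤1+n k)) ⟩
      suc ⌈log₂ (suc k) ⌉     ≡⟨ cong suc (cost-≤2k (s≤s (m≤n+m k j))) ⟨
      suc (cost (suc k))      ≡⟨ cost-+k (n<1+n k) ⟨
      cost (suc (k + k))      ∎
    ... | tri> _ _ 2k<a = begin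
      cost a                   ≡⟨ cost->2k 2k<a ⟩
      suc (cost (a ∸ k))       ≤⟨ s≤s (rec (∸-monoʳ-< z<s k≤a)) ⟩
      suc (cost (suc (a ∸ k))) ≡⟨ cong (λ b → suc (cost b)) (+-∸-assoc 1 k≤a) ⟨
      suc (cost (suc a ∸ k))   ≡⟨ cost->2k (m<n⇒m<1+n 2k<a) ⟨
      cost (suc a)             ∎
      where
      k≤a : k ≤ a
      k≤a = ≤-trans (m≤m+n k k) (<⇒≤ 2k<a)

  cost-mono-≤ : ∀ {a b} → a ≤ b → cost a ≤ cost b
  cost-mono-≤ {a} a≤b = go (≤⇒≤′ a≤b)
    where
    go : ∀ {b} → a ≤′ b → cost a ≤ cost b
    go ≤′-refl        = ≤-refl
    go (≤′-step a≤′b) = ≤-trans (go a≤′b) (cost-≤-suc _)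

  cost-<⇒< : ∀ {a b} → cost a < cost b → a < b
  cost-<⇒< ca<cb = ≰⇒> (λ b≤a → <⇒≱ ca<cb (cost-mono-≤ b≤a))

  cost-≤1 : ∀ {a} → a ≤ 1 → cost a ≡ 0
  cost-≤1 {a} a≤1 = n≤0⇒n≡0 (begin
    cost a        ≡⟨ cost-≤2k (≤-trans a≤1 (s≤s z≤n)) ⟩
    ⌈log₂ a ⌉     ≤⟨ ⌈log₂⌉-mono-≤ a≤1 ⟩
    ⌈log₂ 1 ⌉     ≡⟨ ⌈log₂2^n⌉≡n 0 ⟩
    0             ∎)
    where open ≤-Reasoning

  cost-+-≤ : ∀ {t s m} → t ≤ k → cost t ≤ m → cost s ≤ m → cost (t + s) ≤ suc m
  cost-+-≤ {t} {s} {m} t≤k ct≤m cs≤m with t + s ≤? k + k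
  ... | yes t+s≤2k = begin
    cost (t + s)               ≡⟨ cost-≤2k t+s≤2k ⟩
    ⌈log₂ (t + s) ⌉            ≤⟨ ⌈log₂⌉-mono-≤ (+-mono-≤ (m≤m⊔n t s) (m≤n⊔m t s)) ⟩
    ⌈log₂ (t ⊔ s + (t ⊔ s)) ⌉  ≤⟨ ⌈log₂[n+n]⌉≤1+⌈log₂n⌉ (t ⊔ s) ⟩
    suc ⌈log₂ (t ⊔ s) ⌉        ≡⟨ cong suc (cost-≤2k (≤-trans (m⊔n≤m+n t s) t+s≤2k)) ⟨
    suc (cost (t ⊔ s))         ≡⟨ cong suc (mono-≤-distrib-⊔ cost-mono-≤ t s) ⟩
    suc (cost t ⊔ cost s)      ≤⟨ s≤s (⊔-lub ct≤m cs≤m) ⟩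
    suc m                      ∎
    where open ≤-Reasoning
  ... | no t+s≰2k = begin
    cost (t + s)               ≡⟨ cost->2k (≰⇒> t+s≰2k) ⟩
    suc (cost (t + s ∸ k))     ≤⟨ s≤s (cost-mono-≤ t+s∸k≤s) ⟩
    suc (cost s)               ≤⟨ s≤s cs≤m ⟩
    suc m                      ∎
    where
    open ≤-Reasoning
    t+s∸k≤s : t + s ∸ k ≤ s
    t+s∸k≤s = ≤-trans (∸-monoˡ-≤ k (+-monoˡ-≤ s t≤k)) (≤-reflexive (m+n∸m≡n k s))

  cost-halve : ∀ {a} → 2 ≤ a → a ≤ k + k → cost a ≡ suc (cost ⌈ a /2⌉)
  cost-halve {a} 2≤a a≤2k = begin
    cost a                    ≡⟨ cost-≤2k a≤2k ⟩
    ⌈log₂ a ⌉                 ≡⟨ m+[n∸m]≡n 1≤⌈log₂a⌉ ⟨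
    suc (⌈log₂ a ⌉ ∸ 1)       ≡⟨ cong suc (⌈log₂⌈n/2⌉⌉≡⌈log₂n⌉∸1 a) ⟨
    suc ⌈log₂ ⌈ a /2⌉ ⌉       ≡⟨ cong suc (cost-≤2k (≤-trans (⌈n/2⌉≤n a) a≤2k)) ⟨
    suc (cost ⌈ a /2⌉)        ∎
    where
    open ≡-Reasoning
    1≤⌈log₂a⌉ : 1 ≤ ⌈log₂ a ⌉
    1≤⌈log₂a⌉ = subst (_≤ ⌈log₂ a ⌉) (⌈log₂2^n⌉≡n 1) (⌈log₂⌉-mono-≤ 2≤a)

  -- A test of `part` of the a candidates and k ∸ part of the n ∸ a others,
  -- after which either outcome leaves a cheaper problem.
  record BalancedSplit (n a : ℕ) : Set where
    field
      part       : ℕ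
      part≤k     : part ≤ k
      padding    : k ∸ part ≤ n ∸ a
      cost-part< : cost part < cost a
      cost-rest< : cost (a ∸ part) < cost a

  balanced-split : ∀ {n a} → 2 ≤ a → k + ⌊ a /2⌋ ≤ n → BalancedSplit n a
  balanced-split {n} {a} 2≤a k+⌊a/2⌋≤n with a ≤? k + k
  ... | yes a≤2k = record
    { part       = ⌈ a /2⌉
    ; part≤k     = ≤-trans (⌈n/2⌉-mono a≤2k) (≤-reflexive (sym (n≡⌈n+n/2⌉ k)))
    ; padding    = subst (k ∸ ⌈ a /2⌉ ≤_) n∸⌊a/2⌋∸⌈a/2⌉≡n∸a
                     (∸-monoˡ-≤ ⌈ a /2⌉ (m+n≤o⇒m≤o∸n k k+⌊a/2⌋≤n))
    ; cost-part< = half<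
    ; cost-rest< = ≤-<-trans (cost-mono-≤ a∸⌈a/2⌉≤⌈a/2⌉) half<
    }
    where
    half< : cost ⌈ a /2⌉ < cost a
    half< = ≤-reflexive (sym (cost-halve 2≤a a≤2k))
    n∸⌊a/2⌋∸⌈a/2⌉≡n∸a : n ∸ ⌊ a /2⌋ ∸ ⌈ a /2⌉ ≡ n ∸ a
    n∸⌊a/2⌋∸⌈a/2⌉≡n∸a = trans (∸-+-assoc n ⌊ a /2⌋ ⌈ a /2⌉) (cong (n ∸_) (⌊n/2⌋+⌈n/2⌉≡n a))
    a∸⌈a/2⌉≤⌈a/2⌉ : a ∸ ⌈ a /2⌉ ≤ ⌈ a /2⌉
    a∸⌈a/2⌉≤⌈a/2⌉ = begin
      a ∸ ⌈ a /2⌉                 ≡⟨ cong (_∸ ⌈ a /2⌉) (⌊n/2⌋+⌈n/2⌉≡n a) ⟨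
      ⌊ a /2⌋ + ⌈ a /2⌉ ∸ ⌈ a /2⌉ ≡⟨ m+n∸n≡m ⌊ a /2⌋ ⌈ a /2⌉ ⟩
      ⌊ a /2⌋                     ≤⟨ ⌊n/2⌋≤⌈n/2⌉ a ⟩
      ⌈ a /2⌉                     ∎
      where open ≤-Reasoning
  ... | no a≰2k = record
    { part       = k
    ; part≤k     = ≤-refl
    ; padding    = subst (_≤ n ∸ a) (sym (n∸n≡0 k)) z≤n
    ; cost-part< = ≤-trans (s≤s (cost-mono-≤ (m+n≤o⇒m≤o∸n k (<⇒≤ 2k<a)))) (≤-reflexive (sym cost-a))
    ; cost-rest< = ≤-reflexive (sym cost-a)
    }
    where
    2k<a : k + k < a
    2k<a = ≰⇒> a≰2k
    cost-a : cost a ≡ suc (cost (a ∸ k))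
    cost-a = cost->2k 2k<a

module Optimal (j : ℕ) {n : ℕ} where
  open Cost j

  lowerBound : ∀ {T : Alg n} {m C} → AllTestsSize k T → Identifies T m C → cost ∣ C ∣ ≤ m
  lowerBound {output R} {m} {C} _ idC =
    subst (_≤ m) (sym (cost-≤1 (identifies-output⁻ {C = C} idC))) z≤n
  lowerBound {test S p q} {zero} {C} _ idC =
    ≤-reflexive (cost-≤1 (≤-trans (≤-reflexive (identifies-test-0 {C = C} idC)) z≤n))
  lowerBound {test S p q} {suc m} {C} (∣S∣≡k , sized-p , sized-q) idC =
    subst (λ a → cost a ≤ suc m) (∣p∩q∣+∣p∩∁q∣≡∣p∣ C S)
      (cost-+-≤ ∣C∩S∣≤k (lowerBound sized-p (proj₁ idBranches)) (lowerBound sized-q (proj₂ idBranches)))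
    where
    idBranches = identifies-test⁻ idC
    ∣C∩S∣≤k : ∣ C ∩ S ∣ ≤ k
    ∣C∩S∣≤k = subst (∣ C ∩ S ∣ ≤_) ∣S∣≡k (∣p∩q∣≤∣q∣ C S)

  record Strategy (C : Subset n) : Set where
    field
      tree       : Alg n
      tests-of-k : AllTestsSize k tree
      identifies : Identifies tree (cost ∣ C ∣) C

  test-strategy : ∀ {C} S → ∣ S ∣ ≡ k →
                  cost ∣ C ∩ S ∣ < cost ∣ C ∣ → cost ∣ C ∩ ∁ S ∣ < cost ∣ C ∣ →
                  Strategy (C ∩ S) → Strategy (C ∩ ∁ S) → Strategy C
  test-strategy S ∣S∣≡k c₁ c₂ str₁ str₂ = record
    { tree       = test S (tree str₁) (tree str₂)
    ; tests-of-k = ∣S∣≡k , tests-of-k str₁ , tests-of-k str₂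
    ; identifies = identifies-test (identifies str₁) (identifies str₂) c₁ c₂
    }
    where open Strategy

  balanced-test : ∀ {C} → BalancedSplit n ∣ C ∣ →
                  ∃[ S ] ∣ S ∣ ≡ k × cost ∣ C ∩ S ∣ < cost ∣ C ∣ × cost ∣ C ∩ ∁ S ∣ < cost ∣ C ∣
  balanced-test {C} split with ∃-test-splitting C (<⇒≤ (cost-<⇒< cost-part<))
                                (subst (k ∸ part ≤_) (sym (∣∁p∣≡n∸∣p∣ C)) padding)
    where open BalancedSplit split
  ... | S , ∣S∣≡ , ∣C∩S∣≡ , ∣C∩∁S∣≡ =
    S , trans ∣S∣≡ (m+[n∸m]≡n part≤k) ,
    subst (λ a → cost a < cost ∣ C ∣) (sym ∣C∩S∣≡) cost-part< ,
    subst (λ a → cost a < cost ∣ C ∣) (sym ∣C∩∁S∣≡) cost-rest<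
    where open BalancedSplit split

  Paddable : Subset n → Set
  Paddable C = k + ⌊ ∣ C ∣ /2⌋ ≤ n

  paddable-∩ : ∀ C S → Paddable C → Paddable (C ∩ S)
  paddable-∩ C S = ≤-trans (+-monoʳ-≤ k (⌊n/2⌋-mono (∣p∩q∣≤∣p∣ C S)))

  strategy : ∀ C → Paddable C → Strategy C
  strategy = All.wfRec (On.wellFounded ∣_∣ <-wellFounded) _ (λ C → Paddable C → Strategy C) step
    where
    step : ∀ C → (∀ {D} → ∣ D ∣ < ∣ C ∣ → Paddable D → Strategy D) → Paddable C → Strategy C
    step C rec padC with ∣ C ∣ ≤? 1
    ... | yes ∣C∣≤1 = record { tree = output C ; tests-of-k = tt ; identifies = identifies-output ∣C∣≤1 }
    ... | no  ∣C∣≰1 with balanced-test {C} (balanced-split (≰⇒> ∣C∣≰1) padC)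
    ...   | S , ∣S∣≡k , c₁ , c₂ = test-strategy {C} S ∣S∣≡k c₁ c₂
      (rec {C ∩ S} (cost-<⇒< {∣ C ∩ S ∣} c₁) (paddable-∩ C S padC))
      (rec {C ∩ ∁ S} (cost-<⇒< {∣ C ∩ ∁ S ∣} c₂) (paddable-∩ C (∁ S) padC))

corollary1 : (n k : ℕ) → 0 < k → k < n → 2 * k ≤ n + 1 →
    M[ k ]≡ 1 n (ceilDiv n k ∸ 2 + ⌈log₂ (n ∸ (ceilDiv n k ∸ 2) * k) ⌉)
corollary1 n (suc j) _ _ 2k≤n+1 = (tree , (tests-of-k , solves) , worst) , optimal
  where
  open Cost j
  open Optimal j {n}
  paddable-⊤ : Paddable ⊤
  paddable-⊤ = subst (λ a → k + ⌊ a /2⌋ ≤ n) (sym (∣⊤∣≡n n)) (k+⌊n/2⌋≤n {k} 2k≤n+1)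
  open Strategy (strategy ⊤ paddable-⊤)
  solves : Solves 1 n tree
  solves = proj₁ (identifies⇒solves {T = tree} identifies)
  worst : WorstCaseAtMost 1 n tree (cost n)
  worst = subst (WorstCaseAtMost 1 n tree ∘ cost) (∣⊤∣≡n n) (proj₂ (identifies⇒solves {T = tree} identifies))
  optimal : ∀ A → Admissible k 1 n A → ∀ m → WorstCaseAtMost 1 n A m → cost n ≤ m
  optimal A (sized , solvesA) m worstA =
    subst (λ a → cost a ≤ m) (∣⊤∣≡n n) (lowerBound sized (solves⇒identifies {T = A} solvesA worstA))
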